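{- Let $\mathcal A$ be a set, $F=\mathcal A\times(\cdot)+1$ ($1=\{\bullet\}$), and let $\alpha:X\to\mathcal P(\mathcal A\times X+1)$ be a nondeterministic automaton, viewed as a $\bar F$-coalgebra in $\mathbf{Rel}\cong\mathbf{Kl}(\mathcal P)$. Let $\simeq_X\subseteq\mathcal PX\times\mathcal PX$ be language equivalence on the determinised system. Then $$\simeq_X\ \subseteq\ (|\alpha|\times|\alpha|)^{ -1}\big(\bar\lambda_X(\simeq_X)\big).$$ Moreover, for every $\bar F$-coalgebra homomorphism $f:(X,\alpha)\to(Y,\beta)$ in $\mathbf{Kl}(\mathcal P)$ we have $\simeq_X=(|f|\times|f|)^{ -1}(\simeq_Y)$; consequently, sending each coalgebra $(X,\alpha)$ to the greatest relation $R\subseteq\mathcal PX\times\mathcal PX$ with $R\subseteq(|\alpha|\times|\alpha|)^{ -1}(\bar\lambda_XR)$, and each homomorphism to itself, defines a functor (the behavioural conformance functor) from $\bar F$-coalgebras in $\mathbf{Kl}(\mathcal P)$ to pairs $((X,\alpha),R)$ with $R\subseteq(|\alpha|\times|\alpha|)^{ -1}(\bar\lambda_XR)$.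
   Context: $\mathbf{Kl}(\mathcal P)$: morphisms $X\to Y$ are functions $X\to\mathcal PY$; $|X|=\mathcal PX$ and $|f|(U)=\bigcup_{x\in U}f(x)$. The distributive law $\vartheta_X:\mathcal A\times\mathcal PX+1\to\mathcal P(\mathcal A\times X+1)$ is $(a,U)\mapsto\{a\}\times U$, $\bullet\mapsto\{\bullet\}$, and $\bar F$ is $\bar FX=FX$, $\bar Ff=\vartheta_Y\circ Ff$; a homomorphism $f:(X,\alpha)\to(Y,\beta)$ satisfies $\bar Ff\circ\alpha=\beta\circ f$ (Kleisli composition). The determinised system on $\mathcal PX$: $U\xrightarrow{a}U_a=\{x'\mid\exists x\in U:(a,x')\in\alpha(x)\}$, and $U\!\downarrow$ iff $\exists x\in U:\bullet\in\alpha(x)$; extend to words by $U_\varepsilon=U$, $U_{aw}=(U_a)_w$. Language equivalence: $U\simeq_XU'$ iff for all $w\in\mathcal A^*$, $U_w\!\downarrow\Leftrightarrow U'_w\!\downarrow$. For $R\subseteq\mathcal PX\times\mathcal PX$, $\bar\lambda_X(R)\subseteq\mathcal P(FX)\times\mathcal P(FX)$ is: $\bar U\mathrel{\bar\lambda_XR}\bar U'$ iff ($\bullet\in\bar U\Leftrightarrow\bullet\in\bar U'$) and for all $a$, $\{x\mid(a,x)\in\bar U\}\mathrel R\{x\mid(a,x)\in\bar U'\}$. A morphism of the target category $((X,\alpha),R)\to((Y,\beta),S)$ is a coalgebra homomorphism $f$ with $R\subseteq(|f|\times|f|)^{ -1}S$. -}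

module Defs where

open import Data.Product using (Σ; ∃; ∃-syntax; _×_; _,_)
open import Data.Sum using (_⊎_; inj₁; inj₂)
open import Data.Unit using (⊤; tt)
open import Data.Empty using (⊥)
open import Data.List using (List; []; _∷_)
open import Relation.Binary.PropositionalEquality using (_≡_)
open import Function.Bundles using (_⇔_)
open import Level using (Level; _⊔_) renaming (suc to lsuc; zero to lzero)

𝒫 : Set → Set₁
𝒫 X = X → Set

F : Set → Set → Set
F 𝒜 X = (𝒜 × X) ⊎ ⊤

Kl : Set → Set → Set₁
Kl X Y = X → 𝒫 Y

∣_∣ : {X Y : Set} → Kl X Y → 𝒫 X → 𝒫 Y
∣ f ∣ U y = ∃[ x ] (U x × f x y)

_⊙_ : {X Y Z : Set} → Kl Y Z → Kl X Y → Kl X Z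
(g ⊙ f) x z = ∃[ y ] (f x y × g y z)

ϑ : {𝒜 X : Set} → ((𝒜 × 𝒫 X) ⊎ ⊤) → 𝒫 (F 𝒜 X)
ϑ (inj₁ (a , U)) (inj₁ (b , x)) = (a ≡ b) × U x
ϑ (inj₁ _)       (inj₂ _)       = ⊥
ϑ (inj₂ _)       (inj₁ _)       = ⊥
ϑ (inj₂ _)       (inj₂ _)       = ⊤

-- F f on Set, for f : X → 𝒫Y, giving F X → F (𝒫 Y) ≅ 𝒜 × 𝒫Y + 1
Fmap : {𝒜 X Y : Set} → Kl X Y → F 𝒜 X → (𝒜 × 𝒫 Y) ⊎ ⊤
Fmap f (inj₁ (a , x)) = inj₁ (a , f x)
Fmap f (inj₂ t)       = inj₂ t

F̄ : {𝒜 X Y : Set} → Kl X Y → Kl (F 𝒜 X) (F 𝒜 Y)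
F̄ f z = ϑ (Fmap f z)

Coalg : Set → Set → Set₁
Coalg 𝒜 X = Kl X (F 𝒜 X)

_≐_ : {X Y : Set} → Kl X Y → Kl X Y → Set
f ≐ g = ∀ x y → (f x y ⇔ g x y)

IsHom : {𝒜 X Y : Set} → Coalg 𝒜 X → Coalg 𝒜 Y → Kl X Y → Set
IsHom α β f = (F̄ f ⊙ α) ≐ (β ⊙ f)

step : {𝒜 X : Set} → Coalg 𝒜 X → 𝒫 X → 𝒜 → 𝒫 X
step α U a x′ = ∃[ x ] (U x × α x (inj₁ (a , x′)))

term : {𝒜 X : Set} → Coalg 𝒜 X → 𝒫 X → Set
term α U = ∃[ x ] (U x × α x (inj₂ tt))

steps : {𝒜 X : Set} → Coalg 𝒜 X → 𝒫 X → List 𝒜 → 𝒫 X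
steps α U []      = U
steps α U (a ∷ w) = steps α (step α U a) w

PRel : (ℓ : Level) → Set → Set (lsuc ℓ)
PRel ℓ X = 𝒫 X → 𝒫 X → Set ℓ

LangEq : {𝒜 X : Set} → Coalg 𝒜 X → PRel lzero X
LangEq {𝒜} α U U′ = (w : List 𝒜) → (term α (steps α U w) ⇔ term α (steps α U′ w))

λ̄ : {ℓ : Level} {𝒜 X : Set} → PRel ℓ X → PRel ℓ (F 𝒜 X)
λ̄ {ℓ} {𝒜} R Ū Ū′ =
  (Ū (inj₂ tt) ⇔ Ū′ (inj₂ tt)) ×
  ((a : 𝒜) → R (λ x → Ū (inj₁ (a , x))) (λ x → Ū′ (inj₁ (a , x))))

preimg : {ℓ : Level} {X Y : Set} → (𝒫 X → 𝒫 Y) → PRel ℓ Y → PRel ℓ X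
preimg g S U U′ = S (g U) (g U′)

_⊆ᵣ_ : {ℓ ℓ′ : Level} {X : Set} → PRel ℓ X → PRel ℓ′ X → Set (lsuc lzero ⊔ ℓ ⊔ ℓ′)
R ⊆ᵣ S = ∀ U U′ → R U U′ → S U U′

IsConf : {ℓ : Level} {𝒜 X : Set} → Coalg 𝒜 X → PRel ℓ X → Set (lsuc lzero ⊔ ℓ)
IsConf {ℓ} {𝒜} {X} α R = R ⊆ᵣ preimg ∣ α ∣ (λ̄ {ℓ} {𝒜} {X} R)

-- Greatest such relation (among Set-valued relations): union of all post-fixpoints
νConf : {𝒜 X : Set} → Coalg 𝒜 X → PRel (lsuc lzero) X
νConf {𝒜} {X} α U U′ = Σ (PRel lzero X) λ R → IsConf α R × R U U′

-- Unfolding |α| at • and at an action a gives exactly the acceptance and the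
-- a-successor of the determinised system, so a relation R is a conformance
-- iff R-related sets agree on acceptance and have R-related a-successors.
-- Language equivalence is therefore a conformance, and by induction on words
-- every conformance is contained in it: it is the greatest conformance.
-- For a homomorphism f, |β| ∘ |f| = |β ⊙ f| = |F̄ f ⊙ α| = |F̄ f| ∘ |α|, and
-- |F̄ f| is the identity on • and acts as |f| on each a-component; so |f|
-- commutes with acceptance and successors of the determinised systems and
-- language equivalence is reflected and preserved by |f|.
module Submission where

open import Defs
open import Data.Product using (_×_; _,_; proj₁; proj₂)
open import Data.Sum using (inj₁; inj₂)
open import Data.Unit using (tt)
open import Data.List using (List; []; _∷_)
open import Relation.Binary.PropositionalEquality using (refl)
open import Function.Bundles using (_⇔_; mk⇔; Equivalence)
open import Function.Properties.Equivalence using (⇔-setoid)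
open import Function.Construct.Identity using (⇔-id)
open import Level using (Level)
import Relation.Binary.Reasoning.Setoid as SetoidReasoning

open Equivalence
open SetoidReasoning (⇔-setoid Level.zero)

private
  variable
    𝒜 X Y Z : Set

_≈ₚ_ : 𝒫 X → 𝒫 X → Set
U ≈ₚ V = ∀ x → U x ⇔ V x

∣∣-resp-≈ₚ : (f : Kl X Y) {U V : 𝒫 X} → U ≈ₚ V → ∣ f ∣ U ≈ₚ ∣ f ∣ V
∣∣-resp-≈ₚ f U≈V y = mk⇔
  (λ (x , u , fxy) → x , to (U≈V x) u , fxy)
  (λ (x , v , fxy) → x , from (U≈V x) v , fxy)

∣∣-resp-≐ : {f g : Kl X Y} → f ≐ g → (U : 𝒫 X) → ∣ f ∣ U ≈ₚ ∣ g ∣ U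
∣∣-resp-≐ f≐g U y = mk⇔
  (λ (x , u , fxy) → x , u , to (f≐g x y) fxy)
  (λ (x , u , gxy) → x , u , from (f≐g x y) gxy)

∣∣-⊙ : (g : Kl Y Z) (f : Kl X Y) (U : 𝒫 X) → ∣ g ⊙ f ∣ U ≈ₚ ∣ g ∣ (∣ f ∣ U)
∣∣-⊙ g f U z = mk⇔
  (λ (x , u , y , fxy , gyz) → y , (x , u , fxy) , gyz)
  (λ (y , (x , u , fxy) , gyz) → x , u , y , fxy , gyz)

∣F̄∣-• : (f : Kl X Y) (V : 𝒫 (F 𝒜 X)) → ∣ F̄ f ∣ V (inj₂ tt) ⇔ V (inj₂ tt)
∣F̄∣-• f V = mk⇔
  (λ { (inj₂ tt , v , _) → v ; (inj₁ _ , _ , ()) })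
  (λ v → inj₂ tt , v , tt)

∣F̄∣-inj₁ : (f : Kl X Y) (V : 𝒫 (F 𝒜 X)) (a : 𝒜) →
  (λ y → ∣ F̄ f ∣ V (inj₁ (a , y))) ≈ₚ ∣ f ∣ (λ x → V (inj₁ (a , x)))
∣F̄∣-inj₁ f V a y = mk⇔
  (λ { (inj₁ (_ , x) , v , refl , fxy) → x , v , fxy ; (inj₂ _ , _ , ()) })
  (λ (x , v , fxy) → inj₁ (a , x) , v , refl , fxy)

-- term α U and step α U a are definitionally |α| U at • and at inj₁ (a , _).
module _ (α : Coalg 𝒜 X) where

  term-resp-≈ₚ : {U V : 𝒫 X} → U ≈ₚ V → term α U ⇔ term α V
  term-resp-≈ₚ U≈V = ∣∣-resp-≈ₚ α U≈V (inj₂ tt)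

  step-resp-≈ₚ : {U V : 𝒫 X} → U ≈ₚ V → (a : 𝒜) → step α U a ≈ₚ step α V a
  step-resp-≈ₚ U≈V a x = ∣∣-resp-≈ₚ α U≈V (inj₁ (a , x))

  steps-resp-≈ₚ : {U V : 𝒫 X} → U ≈ₚ V → (w : List 𝒜) → steps α U w ≈ₚ steps α V w
  steps-resp-≈ₚ U≈V []      = U≈V
  steps-resp-≈ₚ U≈V (a ∷ w) = steps-resp-≈ₚ (step-resp-≈ₚ U≈V a) w

  LangEq-isConf : IsConf α (LangEq α)
  LangEq-isConf U U′ U≃U′ = U≃U′ [] , λ a w → U≃U′ (a ∷ w)

  isConf⇒⊆LangEq : {ℓ : Level} {R : PRel ℓ X} → IsConf α R → R ⊆ᵣ LangEq α
  isConf⇒⊆LangEq conf U U′ r []      = proj₁ (conf U U′ r)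
  isConf⇒⊆LangEq conf U U′ r (a ∷ w) =
    isConf⇒⊆LangEq conf (step α U a) (step α U′ a) (proj₂ (conf U U′ r) a) w

  νConf-isConf : IsConf α (νConf α)
  νConf-isConf U U′ (R , conf , r) =
    let (term⇔ , stepR) = conf U U′ r in term⇔ , λ a → R , conf , stepR a

  νConf⊆LangEq : νConf α ⊆ᵣ LangEq α
  νConf⊆LangEq = isConf⇒⊆LangEq νConf-isConf

  LangEq⊆νConf : LangEq α ⊆ᵣ νConf α
  LangEq⊆νConf U U′ U≃U′ = LangEq α , LangEq-isConf , U≃U′

module Homomorphism (α : Coalg 𝒜 X) (β : Coalg 𝒜 Y) (f : Kl X Y) (hom : IsHom α β f) where

  ∣β∣∘∣f∣≈∣F̄f∣∘∣α∣ : (U : 𝒫 X) → ∣ β ∣ (∣ f ∣ U) ≈ₚ ∣ F̄ f ∣ (∣ α ∣ U)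
  ∣β∣∘∣f∣≈∣F̄f∣∘∣α∣ U z = begin
    ∣ β ∣ (∣ f ∣ U) z     ≈˘⟨ ∣∣-⊙ β f U z ⟩
    ∣ β ⊙ f ∣ U z         ≈˘⟨ ∣∣-resp-≐ hom U z ⟩
    ∣ F̄ f ⊙ α ∣ U z       ≈⟨ ∣∣-⊙ (F̄ f) α U z ⟩
    ∣ F̄ f ∣ (∣ α ∣ U) z   ∎

  term-∣∣ : (U : 𝒫 X) → term β (∣ f ∣ U) ⇔ term α U
  term-∣∣ U = begin
    term β (∣ f ∣ U)               ≈⟨ ∣β∣∘∣f∣≈∣F̄f∣∘∣α∣ U (inj₂ tt) ⟩
    ∣ F̄ f ∣ (∣ α ∣ U) (inj₂ tt)   ≈⟨ ∣F̄∣-• f (∣ α ∣ U) ⟩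
    term α U                       ∎

  step-∣∣ : (U : 𝒫 X) (a : 𝒜) → step β (∣ f ∣ U) a ≈ₚ ∣ f ∣ (step α U a)
  step-∣∣ U a y = begin
    step β (∣ f ∣ U) a y                  ≈⟨ ∣β∣∘∣f∣≈∣F̄f∣∘∣α∣ U (inj₁ (a , y)) ⟩
    ∣ F̄ f ∣ (∣ α ∣ U) (inj₁ (a , y))     ≈⟨ ∣F̄∣-inj₁ f (∣ α ∣ U) a y ⟩
    ∣ f ∣ (step α U a) y                  ∎

  steps-∣∣ : (U : 𝒫 X) (w : List 𝒜) → steps β (∣ f ∣ U) w ≈ₚ ∣ f ∣ (steps α U w)
  steps-∣∣ U []      y = ⇔-id _
  steps-∣∣ U (a ∷ w) y = begin
    steps β (step β (∣ f ∣ U) a) w y    ≈⟨ steps-resp-≈ₚ β (step-∣∣ U a) w y ⟩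
    steps β (∣ f ∣ (step α U a)) w y    ≈⟨ steps-∣∣ (step α U a) w y ⟩
    ∣ f ∣ (steps α (step α U a) w) y    ∎

  term-steps-∣∣ : (U : 𝒫 X) (w : List 𝒜) →
    term β (steps β (∣ f ∣ U) w) ⇔ term α (steps α U w)
  term-steps-∣∣ U w = begin
    term β (steps β (∣ f ∣ U) w)    ≈⟨ term-resp-≈ₚ β (steps-∣∣ U w) ⟩
    term β (∣ f ∣ (steps α U w))    ≈⟨ term-∣∣ (steps α U w) ⟩
    term α (steps α U w)            ∎

  LangEq-∣∣ : (U U′ : 𝒫 X) → LangEq α U U′ ⇔ LangEq β (∣ f ∣ U) (∣ f ∣ U′)
  LangEq-∣∣ U U′ = mk⇔
    (λ U≃U′ w → begin
      term β (steps β (∣ f ∣ U) w)     ≈⟨ term-steps-∣∣ U w ⟩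
      term α (steps α U w)             ≈⟨ U≃U′ w ⟩
      term α (steps α U′ w)            ≈˘⟨ term-steps-∣∣ U′ w ⟩
      term β (steps β (∣ f ∣ U′) w)    ∎)
    (λ fU≃fU′ w → begin
      term α (steps α U w)             ≈˘⟨ term-steps-∣∣ U w ⟩
      term β (steps β (∣ f ∣ U) w)     ≈⟨ fU≃fU′ w ⟩
      term β (steps β (∣ f ∣ U′) w)    ≈⟨ term-steps-∣∣ U′ w ⟩
      term α (steps α U′ w)            ∎)

  νConf-∣∣ : νConf α ⊆ᵣ preimg ∣ f ∣ (νConf β)
  νConf-∣∣ U U′ U~U′ =
    LangEq⊆νConf β _ _ (to (LangEq-∣∣ U U′) (νConf⊆LangEq α U U′ U~U′))

theorem8 : (𝒜 : Set) →
    ((X : Set) (α : Coalg 𝒜 X) → IsConf α (LangEq α))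
    × ((X Y : Set) (α : Coalg 𝒜 X) (β : Coalg 𝒜 Y) (f : Kl X Y) → IsHom α β f →
         (U U′ : 𝒫 X) → (LangEq α U U′ ⇔ LangEq β (∣ f ∣ U) (∣ f ∣ U′)))
    × ((X : Set) (α : Coalg 𝒜 X) → IsConf α (νConf α))
    × ((X Y : Set) (α : Coalg 𝒜 X) (β : Coalg 𝒜 Y) (f : Kl X Y) → IsHom α β f →
         νConf α ⊆ᵣ preimg ∣ f ∣ (νConf β))
theorem8 𝒜 =
    (λ X α → LangEq-isConf α)
  , (λ X Y α β f hom → Homomorphism.LangEq-∣∣ α β f hom)
  , (λ X α → νConf-isConf α)
  , (λ X Y α β f hom → Homomorphism.νConf-∣∣ α β f hom)
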